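{- Assume the recurrent-pair setting described in the context. Then for all $m,n\in\mathbb{N}$ with $n\ge n_2$, the term $c_1[m,n]$ starts an infinite $(\Rightarrow_{w_1}^*\circ\Rightarrow_{w_2})$-chain, i.e. there is an infinite sequence of terms $b_0=c_1[m,n],b_1,b_2,\dots$ such that for every $k$, $b_{k+1}$ is obtained from $b_k$ by zero or more $\Rightarrow_{w_1}$-steps followed by exactly one $\Rightarrow_{w_2}$-step.
   Context: $\Sigma$ is a signature, $X$ a countably infinite set of variables, $T(\Sigma,X)$ the terms; $\square,\square'$ are distinct fresh constants. An ARS $(T(\Sigma,X),\Rightarrow_\Pi)$ has $\Rightarrow_\Pi=\bigcup_{\pi\in\Pi}\Rightarrow_\pi$ for binary relations $\Rightarrow_\pi$ on terms; for $w=\langle\pi_1,\dots,\pi_k\rangle\in\Pi^*$, $\Rightarrow_w$ is the composition $\Rightarrow_{\pi_1}\circ\cdots\circ\Rightarrow_{\pi_k}$ (apply $\pi_1$ first), $\Rightarrow_\epsilon$ is the identity, $\Rightarrow_w^*$ its reflexive-transitive closure. The ARS is closed under substitutions if for all terms $s,t$, all $w\in\Pi^*$ and all substitutions $\theta$, $s\Rightarrow_w t$ implies $s\theta\Rightarrow_w t\theta$. Setting: $(T(\Sigma,X),\Rightarrow_\Pi)$ is closed under substitutions; $c_1$ is a term over $\Sigma\cup\{\square,\square'\}\cup X$ containing at least one occurrence of $\square$ and at least one of $\square'$, and $c_1[t,t']$ denotes $c_1$ with every $\square$ replaced by $t$ and every $\square'$ by $t'$; $c_2$ is a term over $\Sigma\cup\{\square\}\cup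 X$ with at least one $\square$, $c_2[t]$ replaces every $\square$ by $t$, $c_2^0=\square$, $c_2^{k+1}=c_2[c_2^k]$. There are $w_1,w_2\in\Pi^*$, variables $x\ne y$ not occurring in $c_1$, terms $s,t$ and $n_1,n_2,n_3,n_4\in\mathbb{N}$ with $u_1\Rightarrow_{w_1}v_1$ and $u_2\Rightarrow_{w_2}v_2$, where $u_1=c_1[x,c_2[y]]$, $v_1=c_1[c_2^{n_1}[x],y]$, $u_2=c_1[x,c_2^{n_2}[s]]$, $v_2=c_1[c_2^{n_3}[t],c_2^{n_4}[x]]$; moreover $c_2$ and $s$ contain no variables, $t\in\{x,s\}$, and $n_4\ge n_2$. For $m,n\in\mathbb{N}$, $c_1[m,n]$ denotes the term $c_1[c_2^m[s],c_2^n[s]]$. -}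

module Defs where

open import Data.Nat using (ℕ; zero; suc)
open import Data.Empty using (⊥)
open import Data.Unit using (⊤; tt)
open import Data.Bool using (Bool; true; false)
open import Data.Vec using (Vec; []; _∷_)
open import Data.List using (List; []; _∷_)
open import Data.Product using (Σ; ∃; _×_; _,_)
open import Relation.Binary.PropositionalEquality using (_≡_)
open import Relation.Binary.Construct.Closure.ReflexiveTransitive using (Star)

record Signature : Set₁ where
  field
    Sym   : Set
    arity : Sym → ℕ

Var : Set
Var = ℕ

module Terms (Sg : Signature) where
  open Signature Sg

  data Tm (H : Set) : Set where
    var  : Var → Tm H
    hole : H → Tm H
    app  : (f : Sym) → Vec (Tm H) (arity f) → Tm H

  Term : Set
  Term = Tm ⊥

  mutual
    plug : ∀ {H H'} → Tm H → (H → Tm H') → Tm H'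
    plug (var v)    σ = var v
    plug (hole h)   σ = σ h
    plug (app f ts) σ = app f (plugs ts σ)

    plugs : ∀ {H H' n} → Vec (Tm H) n → (H → Tm H') → Vec (Tm H') n
    plugs []       σ = []
    plugs (t ∷ ts) σ = plug t σ ∷ plugs ts σ

  mutual
    _[_]ˢ : Term → (Var → Term) → Term
    var v    [ θ ]ˢ = θ v
    hole ()  [ θ ]ˢ
    app f ts [ θ ]ˢ = app f (substs ts θ)

    substs : ∀ {n} → Vec Term n → (Var → Term) → Vec Term n
    substs []       θ = []
    substs (t ∷ ts) θ = (t [ θ ]ˢ) ∷ substs ts θ

  mutual
    data HoleOcc {H : Set} (h : H) : Tm H → Set where
      here : HoleOcc h (hole h)
      arg  : ∀ {f ts} → HoleOccs h ts → HoleOcc h (app f ts)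

    data HoleOccs {H : Set} (h : H) : ∀ {n} → Vec (Tm H) n → Set where
      head : ∀ {n t} {ts : Vec (Tm H) n} → HoleOcc h t → HoleOccs h (t ∷ ts)
      tail : ∀ {n t} {ts : Vec (Tm H) n} → HoleOccs h ts → HoleOccs h (t ∷ ts)

  mutual
    data VarOcc {H : Set} (v : Var) : Tm H → Set where
      here : VarOcc v (var v)
      arg  : ∀ {f ts} → VarOccs v ts → VarOcc v (app f ts)

    data VarOccs {H : Set} (v : Var) : ∀ {n} → Vec (Tm H) n → Set where
      head : ∀ {n t} {ts : Vec (Tm H) n} → VarOcc v t → VarOccs v (t ∷ ts)
      tail : ∀ {n t} {ts : Vec (Tm H) n} → VarOccs v ts → VarOccs v (t ∷ ts)

  -- Two-hole contexts c1 : holes □ = true, □' = false.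
  -- c1[t,t'] replaces every □ by t and every □' by t'.
  fill₂ : Tm Bool → Term → Term → Term
  fill₂ c t t' = plug c λ { true → t ; false → t' }

  fill₁ : Tm ⊤ → Term → Term
  fill₁ c t = plug c λ _ → t

  ctxPow : Tm ⊤ → ℕ → Tm ⊤
  ctxPow c zero    = hole tt
  ctxPow c (suc k) = plug c (λ _ → ctxPow c k)

  pow : Tm ⊤ → ℕ → Term → Term
  pow c k t = fill₁ (ctxPow c k) t

  module ARS {Π : Set} (step : Π → Term → Term → Set) where

    -- ⇒_w for w = ⟨π1,…,πk⟩ : apply π1 first; ⇒_ε is the identity.
    Steps : List Π → Term → Term → Set
    Steps []      s t = s ≡ t
    Steps (π ∷ w) s t = ∃ λ u → step π s u × Steps w u t

    ClosedUnderSubst : Set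
    ClosedUnderSubst =
      ∀ (s t : Term) (w : List Π) (θ : Var → Term) →
        Steps w s t → Steps w (s [ θ ]ˢ) (t [ θ ]ˢ)

    ChainStep : List Π → List Π → Term → Term → Set
    ChainStep w₁ w₂ a b = ∃ λ z → Star (Steps w₁) a z × Steps w₂ z b

    InfiniteChainFrom : List Π → List Π → Term → Set
    InfiniteChainFrom w₁ w₂ a =
      Σ (ℕ → Term) λ b → (b 0 ≡ a) × (∀ k → ChainStep w₁ w₂ (b k) (b (suc k)))

{-# OPTIONS --safe #-}
-- The rule w₁ strips one layer c₂ off the second argument of c₁ (adding n₁ layers to the
-- first), and the rule w₂ fires once exactly n₂ layers remain there, refilling the second
-- argument with n₄ ≥ n₂ layers. Since c₂ and s are ground, both rules instantiate to rewrites
-- between terms c₁[a,b]; from c₁[a,b] with b ≥ n₂ one therefore reaches c₁[a',n₂] by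
-- w₁-steps and then some c₁[a'',b''] with b'' ≥ n₂ by one w₂-step, forever.
module Submission where

open import Defs
open import Data.Nat using (ℕ; zero; suc; _+_; _∸_; _≥_; _≟_)
open import Data.Nat.Properties using (m∸n+n≡m; ≤-trans; m≤m+n)
open import Data.Bool using (Bool; true; false)
open import Data.Unit using (⊤; tt)
open import Data.Empty using (⊥-elim)
open import Data.List using (List)
open import Data.Sum using (_⊎_; inj₁; inj₂)
open import Data.Product using (Σ; ∃; _×_; _,_; proj₁; proj₂)
open import Data.Vec using (Vec; []; _∷_)
open import Level using (Level)
open import Relation.Nullary using (¬_; yes; no)
open import Relation.Binary.PropositionalEquality
  using (_≡_; _≢_; refl; sym; trans; cong; cong₂; subst; subst₂; module ≡-Reasoning)
open import Relation.Binary.Construct.Closure.ReflexiveTransitive using (Star; ε; _◅_)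

module _ {a s r : Level} {A : Set a} {S : Set s} (⌜_⌝ : S → A) (R : A → A → Set r)
         (next : ∀ p → Σ S λ q → R ⌜ p ⌝ ⌜ q ⌝) where

  private
    orbit : S → ℕ → S
    orbit p zero    = p
    orbit p (suc k) = proj₁ (next (orbit p k))

  infinite-chain : ∀ p → Σ (ℕ → A) λ b → (b 0 ≡ ⌜ p ⌝) × (∀ k → R (b k) (b (suc k)))
  infinite-chain p = (λ k → ⌜ orbit p k ⌝) , refl , λ k → proj₂ (next (orbit p k))

module TermLemmas (Sg : Signature) where
  open Terms Sg

  Fixes : ∀ {H} → (Var → Term) → Tm H → Set
  Fixes θ c = ∀ v → VarOcc v c → θ v ≡ var v

  Ground : ∀ {H} → Tm H → Set
  Ground c = ∀ v → ¬ VarOcc v c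

  ground-fixes : ∀ {H} {c : Tm H} (θ : Var → Term) → Ground c → Fixes θ c
  ground-fixes θ gc v o = ⊥-elim (gc v o)

  mutual
    plug-cong : ∀ {H H'} (c : Tm H) {σ σ' : H → Tm H'} →
                (∀ h → σ h ≡ σ' h) → plug c σ ≡ plug c σ'
    plug-cong (var v)    e = refl
    plug-cong (hole h)   e = e h
    plug-cong (app f ts) e = cong (app f) (plugs-cong ts e)

    plugs-cong : ∀ {H H' n} (ts : Vec (Tm H) n) {σ σ' : H → Tm H'} →
                 (∀ h → σ h ≡ σ' h) → plugs ts σ ≡ plugs ts σ'
    plugs-cong []       e = refl
    plugs-cong (t ∷ ts) e = cong₂ _∷_ (plug-cong t e) (plugs-cong ts e)

  mutual
    plug-plug : ∀ {H H' H''} (c : Tm H) (τ : H → Tm H') (σ : H' → Tm H'') →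
                plug (plug c τ) σ ≡ plug c (λ h → plug (τ h) σ)
    plug-plug (var v)    τ σ = refl
    plug-plug (hole h)   τ σ = refl
    plug-plug (app f ts) τ σ = cong (app f) (plugs-plugs ts τ σ)

    plugs-plugs : ∀ {H H' H'' n} (ts : Vec (Tm H) n) (τ : H → Tm H') (σ : H' → Tm H'') →
                  plugs (plugs ts τ) σ ≡ plugs ts (λ h → plug (τ h) σ)
    plugs-plugs []       τ σ = refl
    plugs-plugs (t ∷ ts) τ σ = cong₂ _∷_ (plug-plug t τ σ) (plugs-plugs ts τ σ)

  mutual
    plug-[]ˢ : ∀ {H} (c : Tm H) (σ : H → Term) (θ : Var → Term) → Fixes θ c →
               plug c σ [ θ ]ˢ ≡ plug c (λ h → σ h [ θ ]ˢ)
    plug-[]ˢ (var v)    σ θ fix = fix v here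
    plug-[]ˢ (hole h)   σ θ fix = refl
    plug-[]ˢ (app f ts) σ θ fix = cong (app f) (plugs-substs ts σ θ (λ v o → fix v (arg o)))

    plugs-substs : ∀ {H n} (ts : Vec (Tm H) n) (σ : H → Term) (θ : Var → Term) →
                   (∀ v → VarOccs v ts → θ v ≡ var v) →
                   substs (plugs ts σ) θ ≡ plugs ts (λ h → σ h [ θ ]ˢ)
    plugs-substs []       σ θ fix = refl
    plugs-substs (t ∷ ts) σ θ fix =
      cong₂ _∷_ (plug-[]ˢ t σ θ (λ v o → fix v (head o)))
                (plugs-substs ts σ θ (λ v o → fix v (tail o)))

  mutual
    []ˢ-fixed : (t : Term) (θ : Var → Term) → Fixes θ t → t [ θ ]ˢ ≡ t
    []ˢ-fixed (var v)    θ fix = fix v here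
    []ˢ-fixed (hole ())  θ fix
    []ˢ-fixed (app f ts) θ fix = cong (app f) (substs-fixed ts θ (λ v o → fix v (arg o)))

    substs-fixed : ∀ {n} (ts : Vec Term n) (θ : Var → Term) →
                   (∀ v → VarOccs v ts → θ v ≡ var v) → substs ts θ ≡ ts
    substs-fixed []       θ fix = refl
    substs-fixed (t ∷ ts) θ fix =
      cong₂ _∷_ ([]ˢ-fixed t θ (λ v o → fix v (head o))) (substs-fixed ts θ (λ v o → fix v (tail o)))

  []ˢ-ground : (t : Term) (θ : Var → Term) → Ground t → t [ θ ]ˢ ≡ t
  []ˢ-ground t θ gt = []ˢ-fixed t θ (ground-fixes θ gt)

  fill₂-[]ˢ : (c : Tm Bool) (u u' : Term) (θ : Var → Term) → Fixes θ c →
              fill₂ c u u' [ θ ]ˢ ≡ fill₂ c (u [ θ ]ˢ) (u' [ θ ]ˢ)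
  fill₂-[]ˢ c u u' θ fix =
    trans (plug-[]ˢ c _ θ fix) (plug-cong c λ { true → refl ; false → refl })

  fill₁-[]ˢ : (c : Tm ⊤) → Ground c → (u : Term) (θ : Var → Term) →
              fill₁ c u [ θ ]ˢ ≡ fill₁ c (u [ θ ]ˢ)
  fill₁-[]ˢ c gc u θ = plug-[]ˢ c _ θ (ground-fixes θ gc)

  pow-suc : (c : Tm ⊤) (k : ℕ) (u : Term) → pow c (suc k) u ≡ fill₁ c (pow c k u)
  pow-suc c k u = plug-plug c (λ _ → ctxPow c k) (λ _ → u)

  pow-+ : (c : Tm ⊤) (i j : ℕ) (u : Term) → pow c i (pow c j u) ≡ pow c (i + j) u
  pow-+ c zero    j u = refl
  pow-+ c (suc i) j u = begin
    pow c (suc i) (pow c j u)   ≡⟨ pow-suc c i (pow c j u) ⟩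
    fill₁ c (pow c i (pow c j u)) ≡⟨ plug-cong c (λ _ → pow-+ c i j u) ⟩
    fill₁ c (pow c (i + j) u)   ≡⟨ sym (pow-suc c (i + j) u) ⟩
    pow c (suc i + j) u         ∎
    where open ≡-Reasoning

  pow-[]ˢ : (c : Tm ⊤) → Ground c → (k : ℕ) (u : Term) (θ : Var → Term) →
            pow c k u [ θ ]ˢ ≡ pow c k (u [ θ ]ˢ)
  pow-[]ˢ c gc zero    u θ = refl
  pow-[]ˢ c gc (suc k) u θ = begin
    pow c (suc k) u [ θ ]ˢ                ≡⟨ cong (_[ θ ]ˢ) (pow-suc c k u) ⟩
    fill₁ c (pow c k u) [ θ ]ˢ            ≡⟨ fill₁-[]ˢ c gc (pow c k u) θ ⟩
    fill₁ c (pow c k u [ θ ]ˢ)            ≡⟨ plug-cong c (λ _ → pow-[]ˢ c gc k u θ) ⟩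
    fill₁ c (pow c k (u [ θ ]ˢ))          ≡⟨ sym (pow-suc c k (u [ θ ]ˢ)) ⟩
    pow c (suc k) (u [ θ ]ˢ)              ∎
    where open ≡-Reasoning

module RecurrentPair (Sg : Signature) where
  open Terms Sg
  open TermLemmas Sg

  module _ {Π : Set} (step : Π → Term → Term → Set) where
    open ARS step

    module _
      (closed : ClosedUnderSubst)
      (c₁ : Tm Bool) (c₂ : Tm ⊤) (ground-c₂ : Ground c₂)
      (w₁ w₂ : List Π) (x y : Var) (x≢y : x ≢ y) (x∉c₁ : ¬ VarOcc x c₁) (y∉c₁ : ¬ VarOcc y c₁)
      (s t : Term) (ground-s : Ground s) (t≡x⊎t≡s : t ≡ var x ⊎ t ≡ s)
      (n₁ n₂ n₃ n₄ : ℕ) (n₄≥n₂ : n₄ ≥ n₂)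
      (rule₁ : Steps w₁ (fill₂ c₁ (var x) (fill₁ c₂ (var y)))
                        (fill₂ c₁ (pow c₂ n₁ (var x)) (var y)))
      (rule₂ : Steps w₂ (fill₂ c₁ (var x) (pow c₂ n₂ s))
                        (fill₂ c₁ (pow c₂ n₃ t) (pow c₂ n₄ (var x))))
      where

      open ≡-Reasoning

      c₁⟨_,_⟩ : ℕ → ℕ → Term
      c₁⟨ i , j ⟩ = fill₂ c₁ (pow c₂ i s) (pow c₂ j s)

      [x↦_,y↦_] : Term → Term → Var → Term
      [x↦ u ,y↦ u' ] v with v ≟ x | v ≟ y
      ... | yes _ | _     = u
      ... | no _  | yes _ = u'
      ... | no _  | no _  = var v

      [x↦]-x : ∀ u u' → [x↦ u ,y↦ u' ] x ≡ u
      [x↦]-x u u' with x ≟ x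
      ... | yes _   = refl
      ... | no x≢x  = ⊥-elim (x≢x refl)

      [x↦]-y : ∀ u u' → [x↦ u ,y↦ u' ] y ≡ u'
      [x↦]-y u u' with y ≟ x | y ≟ y
      ... | yes y≡x | _       = ⊥-elim (x≢y (sym y≡x))
      ... | no _    | yes _   = refl
      ... | no _    | no y≢y  = ⊥-elim (y≢y refl)

      [x↦]-fixes-c₁ : ∀ u u' → Fixes [x↦ u ,y↦ u' ] c₁
      [x↦]-fixes-c₁ u u' v o with v ≟ x | v ≟ y
      ... | yes refl | _        = ⊥-elim (x∉c₁ o)
      ... | no _     | yes refl = ⊥-elim (y∉c₁ o)
      ... | no _     | no _     = refl

      c₁-[x↦] : ∀ u u' l r → fill₂ c₁ l r [ [x↦ u ,y↦ u' ] ]ˢ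
                            ≡ fill₂ c₁ (l [ [x↦ u ,y↦ u' ] ]ˢ) (r [ [x↦ u ,y↦ u' ] ]ˢ)
      c₁-[x↦] u u' l r = fill₂-[]ˢ c₁ l r _ ([x↦]-fixes-c₁ u u')

      pow-s-[]ˢ : ∀ j θ → pow c₂ j s [ θ ]ˢ ≡ pow c₂ j s
      pow-s-[]ˢ j θ = trans (pow-[]ˢ c₂ ground-c₂ j s θ) (cong (pow c₂ j) ([]ˢ-ground s θ ground-s))

      pow-x-[x↦] : ∀ j i u' → pow c₂ j (var x) [ [x↦ pow c₂ i s ,y↦ u' ] ]ˢ ≡ pow c₂ (j + i) s
      pow-x-[x↦] j i u' = begin
        pow c₂ j (var x) [ [x↦ pow c₂ i s ,y↦ u' ] ]ˢ ≡⟨ pow-[]ˢ c₂ ground-c₂ j (var x) _ ⟩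
        pow c₂ j ([x↦ pow c₂ i s ,y↦ u' ] x)          ≡⟨ cong (pow c₂ j) ([x↦]-x _ u') ⟩
        pow c₂ j (pow c₂ i s)                          ≡⟨ pow-+ c₂ j i s ⟩
        pow c₂ (j + i) s                               ∎

      t-[x↦] : ∀ i u' → ∃ λ i' → t [ [x↦ pow c₂ i s ,y↦ u' ] ]ˢ ≡ pow c₂ i' s
      t-[x↦] i u' = by-cases t≡x⊎t≡s
        where
        θ : Var → Term
        θ = [x↦ pow c₂ i s ,y↦ u' ]

        by-cases : t ≡ var x ⊎ t ≡ s → ∃ λ i' → t [ θ ]ˢ ≡ pow c₂ i' s
        by-cases (inj₁ t≡x) = i , trans (cong (_[ θ ]ˢ) t≡x) ([x↦]-x _ u')
        by-cases (inj₂ t≡s) = 0 , trans (cong (_[ θ ]ˢ) t≡s) ([]ˢ-ground s θ ground-s)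

      w₁-step : ∀ i k → Steps w₁ c₁⟨ i , suc k ⟩ c₁⟨ n₁ + i , k ⟩
      w₁-step i k = subst₂ (Steps w₁) lhs rhs (closed _ _ w₁ θ rule₁)
        where
        θ : Var → Term
        θ = [x↦ pow c₂ i s ,y↦ pow c₂ k s ]

        lhs : fill₂ c₁ (var x) (fill₁ c₂ (var y)) [ θ ]ˢ ≡ c₁⟨ i , suc k ⟩
        lhs = begin
          fill₂ c₁ (var x) (fill₁ c₂ (var y)) [ θ ]ˢ      ≡⟨ c₁-[x↦] _ _ (var x) (fill₁ c₂ (var y)) ⟩
          fill₂ c₁ (θ x) (fill₁ c₂ (var y) [ θ ]ˢ)       ≡⟨ cong₂ (fill₂ c₁) ([x↦]-x _ _)
                                                                  (fill₁-[]ˢ c₂ ground-c₂ (var y) θ) ⟩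
          fill₂ c₁ (pow c₂ i s) (fill₁ c₂ (θ y))          ≡⟨ cong (λ u → fill₂ c₁ (pow c₂ i s) (fill₁ c₂ u))
                                                                  ([x↦]-y _ _) ⟩
          fill₂ c₁ (pow c₂ i s) (fill₁ c₂ (pow c₂ k s))   ≡⟨ cong (fill₂ c₁ (pow c₂ i s)) (sym (pow-suc c₂ k s)) ⟩
          c₁⟨ i , suc k ⟩                                  ∎

        rhs : fill₂ c₁ (pow c₂ n₁ (var x)) (var y) [ θ ]ˢ ≡ c₁⟨ n₁ + i , k ⟩
        rhs = trans (c₁-[x↦] _ _ (pow c₂ n₁ (var x)) (var y))
                    (cong₂ (fill₂ c₁) (pow-x-[x↦] n₁ i _) ([x↦]-y _ _))

      w₂-step : ∀ i → ∃ λ i' → Steps w₂ c₁⟨ i , n₂ ⟩ c₁⟨ i' , n₄ + i ⟩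
      w₂-step i = n₃ + i' , subst₂ (Steps w₂) lhs rhs (closed _ _ w₂ θ rule₂)
        where
        θ : Var → Term
        θ = [x↦ pow c₂ i s ,y↦ var y ]

        i' : ℕ
        i' = proj₁ (t-[x↦] i (var y))

        lhs : fill₂ c₁ (var x) (pow c₂ n₂ s) [ θ ]ˢ ≡ c₁⟨ i , n₂ ⟩
        lhs = trans (c₁-[x↦] _ _ (var x) (pow c₂ n₂ s))
                    (cong₂ (fill₂ c₁) ([x↦]-x _ _) (pow-s-[]ˢ n₂ θ))

        pow-t-[]ˢ : pow c₂ n₃ t [ θ ]ˢ ≡ pow c₂ (n₃ + i') s
        pow-t-[]ˢ = begin
          pow c₂ n₃ t [ θ ]ˢ      ≡⟨ pow-[]ˢ c₂ ground-c₂ n₃ t θ ⟩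
          pow c₂ n₃ (t [ θ ]ˢ)    ≡⟨ cong (pow c₂ n₃) (proj₂ (t-[x↦] i (var y))) ⟩
          pow c₂ n₃ (pow c₂ i' s) ≡⟨ pow-+ c₂ n₃ i' s ⟩
          pow c₂ (n₃ + i') s      ∎

        rhs : fill₂ c₁ (pow c₂ n₃ t) (pow c₂ n₄ (var x)) [ θ ]ˢ ≡ c₁⟨ n₃ + i' , n₄ + i ⟩
        rhs = trans (c₁-[x↦] _ _ (pow c₂ n₃ t) (pow c₂ n₄ (var x)))
                    (cong₂ (fill₂ c₁) pow-t-[]ˢ (pow-x-[x↦] n₄ i _))

      w₁-steps : ∀ d i → ∃ λ i' → Star (Steps w₁) c₁⟨ i , d + n₂ ⟩ c₁⟨ i' , n₂ ⟩
      w₁-steps zero    i = i , ε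
      w₁-steps (suc d) i with w₁-steps d (n₁ + i)
      ... | i' , steps = i' , w₁-step i (d + n₂) ◅ steps

      Recurrent : Set
      Recurrent = Σ ℕ λ i → Σ ℕ λ j → j ≥ n₂

      ⌜_⌝ : Recurrent → Term
      ⌜ i , j , _ ⌝ = c₁⟨ i , j ⟩

      chain-step : (p : Recurrent) → Σ Recurrent λ q → ChainStep w₁ w₂ ⌜ p ⌝ ⌜ q ⌝
      chain-step (i , j , j≥n₂) with w₁-steps (j ∸ n₂) i
      ... | i' , w₁-run with w₂-step i'
      ... | i'' , w₂-run = (i'' , n₄ + i' , n₄+i'≥n₂) , c₁⟨ i' , n₂ ⟩ , w₁-run′ , w₂-run
        where
        n₄+i'≥n₂ : n₄ + i' ≥ n₂
        n₄+i'≥n₂ = ≤-trans n₄≥n₂ (m≤m+n n₄ i')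

        w₁-run′ : Star (Steps w₁) c₁⟨ i , j ⟩ c₁⟨ i' , n₂ ⟩
        w₁-run′ = subst (λ j' → Star (Steps w₁) c₁⟨ i , j' ⟩ c₁⟨ i' , n₂ ⟩) (m∸n+n≡m j≥n₂) w₁-run

      infinite-chain-from : ∀ m n → n ≥ n₂ → InfiniteChainFrom w₁ w₂ c₁⟨ m , n ⟩
      infinite-chain-from m n n≥n₂ = infinite-chain ⌜_⌝ (ChainStep w₁ w₂) chain-step (m , n , n≥n₂)

corollary1 : (Sg : Signature) → let open Terms Sg in
    {Π : Set} (step : Π → Term → Term → Set) → let open ARS step in
    ClosedUnderSubst →
    (c₁ : Tm Bool) → HoleOcc true c₁ → HoleOcc false c₁ →
    (c₂ : Tm ⊤) → HoleOcc tt c₂ →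
    (w₁ w₂ : List Π) (x y : Var) → x ≢ y →
    ¬ VarOcc x c₁ → ¬ VarOcc y c₁ →
    (s t : Term) (n₁ n₂ n₃ n₄ : ℕ) →
    Steps w₁ (fill₂ c₁ (var x) (fill₁ c₂ (var y)))
    (fill₂ c₁ (pow c₂ n₁ (var x)) (var y)) →
    Steps w₂ (fill₂ c₁ (var x) (pow c₂ n₂ s))
    (fill₂ c₁ (pow c₂ n₃ t) (pow c₂ n₄ (var x))) →
    (∀ v → ¬ VarOcc v c₂) → (∀ v → ¬ VarOcc v s) →
    (t ≡ var x ⊎ t ≡ s) → n₄ ≥ n₂ →
    ∀ (m n : ℕ) → n ≥ n₂ →
    InfiniteChainFrom w₁ w₂ (fill₂ c₁ (pow c₂ m s) (pow c₂ n s))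
-- The hole-occurrence hypotheses only rule out degenerate pairs; the chain exists without them.
corollary1 Sg step closed c₁ _ _ c₂ _ w₁ w₂ x y x≢y x∉c₁ y∉c₁ s t n₁ n₂ n₃ n₄
           rule₁ rule₂ ground-c₂ ground-s t≡x⊎t≡s n₄≥n₂ =
  RecurrentPair.infinite-chain-from Sg step closed c₁ c₂ ground-c₂ w₁ w₂ x y x≢y x∉c₁ y∉c₁
    s t ground-s t≡x⊎t≡s n₁ n₂ n₃ n₄ n₄≥n₂ rule₁ rule₂
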